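{- For each integer $k \in \mathbb{Z}\setminus\{ -1,0,1\}$ there are infinitely many pairs of integers $(A,B)$ such that $\gcd(A,B)$ is square-free and the Diophantine equation $x^2 = A k^{n} + B$ has at least four solutions $(x,n)$ in non-negative integers. -}

module Defs where

open import Data.Nat as ℕ using (ℕ)
open import Data.Nat.Divisibility using (_∣_)
open import Data.Nat.GCD using (gcd)
open import Data.Integer as ℤ using (ℤ; ∣_∣)
open import Data.Fin using (Fin)
open import Data.Product using (_×_; Σ; _,_)
open import Function.Definitions using (Injective)
open import Relation.Binary.PropositionalEquality using (_≡_)

-- square-free natural number: the only d with d² ∣ m is d = 1
-- (so 0 is not square-free)
SquareFree : ℕ → Set
SquareFree m = ∀ (d : ℕ) → d ℕ.* d ∣ m → d ≡ 1

gcdℤ : ℤ → ℤ → ℕ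
gcdℤ a b = gcd ∣ a ∣ ∣ b ∣

IsSolution : ℤ → ℤ → ℤ → ℕ × ℕ → Set
IsSolution k A B (x , n) = ℤ.+ x ℤ.* ℤ.+ x ≡ A ℤ.* (k ℤ.^ n) ℤ.+ B

AtLeastFourSolutions : ℤ → ℤ → ℤ → Set
AtLeastFourSolutions k A B =
  Σ (Fin 4 → ℕ × ℕ) λ s → Injective _≡_ _≡_ s × (∀ i → IsSolution k A B (s i))

Good : ℤ → ℤ × ℤ → Set
Good k (A , B) = SquareFree (gcdℤ A B) × AtLeastFourSolutions k A B

{-# OPTIONS --safe #-}
module Submission where

open import Defs
open import Data.Nat using (ℕ; _≤_)
open import Data.Integer using (ℤ; ∣_∣)
open import Data.Product using (_×_; Σ)
open import Function.Definitions using (Injective)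
open import Relation.Binary.PropositionalEquality using (_≡_)

open import Data.Nat as ℕ using (zero; suc; NonZero; _<_; s<s)
import Data.Nat.Properties as ℕ
open import Data.Nat.Divisibility using (_∣_; ∣-trans; ∣1⇒≡1)
open import Data.Integer.GCD using (gcd[i,j]∣i; gcd[i,j]∣j)
open import Data.Nat.Coprimality using (Coprime; coprime-divisor)
open import Data.Nat.Primality using (irreducible[2])
open import Data.Integer as ℤ using (+_; -[1+_]; _+_; _*_; _-_; _^_)
import Data.Integer.Properties as ℤ
open import Algebra.Properties.AbelianGroup ℤ.+-0-abelianGroup using () renaming (∙-cancelˡ to +-cancelˡ)
import Data.Integer.Divisibility.Signed as Signed
open import Data.Integer.DivMod using (_/_; _%_; a≡a%n+[a/n]*n; n%d<d)
open import Data.Integer.Tactic.RingSolver using (solve-∀)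
open import Data.Integer.Solver using (module +-*-Solver)
open +-*-Solver using (Polynomial; ⟦_⟧; con; var; _:+_; _:-_; :-_; _:*_; _:^_; _:=_; solve)
open import Data.Fin using (Fin; toℕ) renaming (zero to 0F; suc to sucF)
open import Data.Fin.Properties using (toℕ-injective)
open import Data.Vec using ([]; _∷_)
open import Data.Product using (_,_; ∃; proj₁; proj₂)
open import Data.Sum using (_⊎_; inj₁; inj₂)
open import Function using (_∘_)
open import Relation.Nullary using (¬_; contradiction)
open import Relation.Binary.PropositionalEquality using (_≢_; refl; sym; trans; cong; subst; module ≡-Reasoning)
open import Relation.Binary.Definitions using (tri<; tri≈; tri>)

-- For a parameter K put A = 8 (1 + K + K² + K³), B = 1 − 2K − K² − 12K³ − K⁴ − 2K⁵ + K⁶;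
-- four explicit cubics x₀, …, x₃ satisfy xₙ² = A Kⁿ + B identically. Taking K = kʳ
-- turns them into the solutions (|xₙ|, r n) of x² = A kⁿ + B. A polynomial Bézout
-- identity U A + V B = 2⁸ shows that gcd(A, B) is a power of two, and for even K the
-- number B is odd, so gcd(A, B) = 1. For odd K = 1 + 2J the numbers A, B, xₙ are
-- divisible by 16, 16, 4, and dividing out gives a second family in J with U A + V B = 1
-- and B odd. Distinct r give distinct pairs: A determines K because the cubic
-- 1 + K + K² + K³ is injective on ℤ, and K = kʳ determines r because |k| ≥ 2.

Even Odd : ℤ → Set
Even a = ∃ λ j → a ≡ + 2 * j
Odd a = ∃ λ j → a ≡ + 1 + + 2 * j

even⊎odd : ∀ a → Even a ⊎ Odd a
even⊎odd a with a % + 2 | n%d<d a (+ 2) | a≡a%n+[a/n]*n a (+ 2)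
... | 0 | _ | a≡r+2q = inj₁ (a / + 2 , trans a≡r+2q (trans (ℤ.+-identityˡ _) (ℤ.*-comm (a / + 2) (+ 2))))
... | 1 | _ | a≡r+2q = inj₂ (a / + 2 , trans a≡r+2q (cong (_+_ (+ 1)) (ℤ.*-comm (a / + 2) (+ 2))))
... | suc (suc _) | s<s (s<s ()) | _

even-^-suc : ∀ {a} → Even a → ∀ n → Even (a ^ suc n)
even-^-suc {a} (j , refl) n = j * a ^ n , ℤ.*-assoc (+ 2) j (a ^ n)

odd-* : ∀ {a b} → Odd a → Odd b → Odd (a * b)
odd-* (i , refl) (j , refl) = i + j + + 2 * i * j , expand i j
  where
  expand : ∀ i j → (+ 1 + + 2 * i) * (+ 1 + + 2 * j) ≡ + 1 + + 2 * (i + j + + 2 * i * j)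
  expand = solve-∀

odd-^ : ∀ {a} → Odd a → ∀ n → Odd (a ^ n)
odd-^ odd-a zero    = + 0 , refl
odd-^ odd-a (suc n) = odd-* odd-a (odd-^ odd-a n)

odd⇒2∤ : ∀ {a} → Odd a → ¬ 2 ∣ ∣ a ∣
odd⇒2∤ (j , refl) 2∣a = contradiction (∣1⇒≡1 (Signed.∣⇒∣ᵤ 2∣1)) λ ()
  where
  2∣1 : + 2 Signed.∣ + 1
  2∣1 = Signed.∣m+n∣n⇒∣m (Signed.∣ᵤ⇒∣ 2∣a) (Signed.∣m⇒∣m*n j Signed.∣-refl)

coprime∧∣^⇒≡1 : ∀ {d n} m → Coprime d n → d ∣ n ℕ.^ m → d ≡ 1
coprime∧∣^⇒≡1 zero    _      d∣1     = ∣1⇒≡1 d∣1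
coprime∧∣^⇒≡1 (suc m) cop-dn d∣n^1+m = coprime∧∣^⇒≡1 m cop-dn (coprime-divisor cop-dn d∣n^1+m)

2∤⇒coprime-2 : ∀ {d} → ¬ 2 ∣ d → Coprime d 2
2∤⇒coprime-2 2∤d (i∣d , i∣2) with irreducible[2] i∣2
... | inj₁ i≡1 = i≡1
... | inj₂ refl = contradiction i∣d 2∤d

gcdℤ∣combination : ∀ {A B} U V → gcdℤ A B ∣ ∣ U * A + V * B ∣
gcdℤ∣combination {A} {B} U V = Signed.∣⇒∣ᵤ {+ gcdℤ A B} (Signed.∣m∣n⇒∣m+n
  (Signed.∣n⇒∣m*n U (Signed.∣ᵤ⇒∣ (gcd[i,j]∣i A B)))
  (Signed.∣n⇒∣m*n V (Signed.∣ᵤ⇒∣ (gcd[i,j]∣j A B))))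

gcdℤ≡1 : ∀ {A B} U V m → U * A + V * B ≡ + (2 ℕ.^ m) → Odd B → gcdℤ A B ≡ 1
gcdℤ≡1 {A} {B} U V m UA+VB≡2^m odd-B = coprime∧∣^⇒≡1 m (2∤⇒coprime-2 2∤g) g∣2^m
  where
  g∣2^m : gcdℤ A B ∣ 2 ℕ.^ m
  g∣2^m = subst (λ c → gcdℤ A B ∣ ∣ c ∣) UA+VB≡2^m (gcdℤ∣combination U V)
  2∤g : ¬ 2 ∣ gcdℤ A B
  2∤g 2∣g = odd⇒2∤ odd-B (∣-trans 2∣g (gcd[i,j]∣j A B))

squareFree-1 : SquareFree 1
squareFree-1 d d*d∣1 = ℕ.m*n≡1⇒n≡1 d d (∣1⇒≡1 d*d∣1)

abs-square : ∀ x → + ∣ x ∣ * + ∣ x ∣ ≡ x * x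
abs-square (+ n)    = refl
abs-square -[1+ n ] = refl

isSolution-power : ∀ {k A B x} r n → x * x ≡ A * (k ^ r) ^ n + B →
                   IsSolution k A B (∣ x ∣ , r ℕ.* n)
isSolution-power {k} {A} {B} {x} r n x²≡ = begin
  + ∣ x ∣ * + ∣ x ∣      ≡⟨ abs-square x ⟩
  x * x                  ≡⟨ x²≡ ⟩
  A * (k ^ r) ^ n + B    ≡⟨ cong (λ t → A * t + B) (ℤ.^-*-assoc k r n) ⟩
  A * k ^ (r ℕ.* n) + B  ∎
  where open ≡-Reasoning

atLeastFourSolutions-power : ∀ {k A B} r .{{_ : NonZero r}} (x : Fin 4 → ℤ) →
                             (∀ n → x n * x n ≡ A * (k ^ r) ^ toℕ n + B) →
                             AtLeastFourSolutions k A B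
atLeastFourSolutions-power {k} {A} {B} r x squares =
  (λ n → ∣ x n ∣ , r ℕ.* toℕ n) ,
  (λ same → toℕ-injective (ℕ.*-cancelˡ-≡ _ _ r (cong proj₂ same))) ,
  (λ n → isSolution-power {k} {A} {B} {x n} r (toℕ n) (squares n))

abs-^ : ∀ i n → ∣ i ^ n ∣ ≡ ∣ i ∣ ℕ.^ n
abs-^ i zero    = refl
abs-^ i (suc n) = trans (ℤ.abs-* i (i ^ n)) (cong (∣ i ∣ ℕ.*_) (abs-^ i n))

^-injectiveʳ-ℕ : ∀ {m} → 1 < m → Injective _≡_ _≡_ (m ℕ.^_)
^-injectiveʳ-ℕ {m} 1<m {a} {b} m^a≡m^b with ℕ.<-cmp a b
... | tri< a<b _ _ = contradiction m^a≡m^b (ℕ.<⇒≢ (ℕ.^-monoʳ-< m 1<m a<b))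
... | tri≈ _ a≡b _ = a≡b
... | tri> _ _ a>b = contradiction m^a≡m^b (ℕ.>⇒≢ (ℕ.^-monoʳ-< m 1<m a>b))

^-injectiveʳ : ∀ k → 2 ≤ ∣ k ∣ → Injective _≡_ _≡_ (k ^_)
^-injectiveʳ k 2≤∣k∣ {a} {b} k^a≡k^b =
  ^-injectiveʳ-ℕ 2≤∣k∣ (trans (sym (abs-^ k a)) (trans (cong ∣_∣ k^a≡k^b) (abs-^ k b)))

square-nonneg : ∀ a → a * a ≡ + (∣ a ∣ ℕ.* ∣ a ∣)
square-nonneg a = trans (sym (abs-square a)) (sym (ℤ.pos-* ∣ a ∣ ∣ a ∣))

2+squares≢0 : ∀ a b c → + 2 + (a * a + b * b + (c * c + c * c)) ≢ + 0
2+squares≢0 a b c rewrite square-nonneg a | square-nonneg b | square-nonneg c = λ ()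

-- Polynomials are written in the syntax of the ring solver and evaluated with eval, so
-- each polynomial identity below is checked by the solver against the definitions.
eval : (∀ {n} → Polynomial n → Polynomial n) → ℤ → ℤ
eval p K = ⟦ p (var 0F) ⟧ (K ∷ [])

cubicᴾ : ∀ {n} → Polynomial n → Polynomial n
cubicᴾ K = con (+ 1) :+ K :+ K :^ 2 :+ K :^ 3

cubic : ℤ → ℤ
cubic = eval cubicᴾ

cubic-difference : ∀ K L → cubic K - cubic L ≡ (K - L) * (K * K + K * L + L * L + K + L + + 1)
cubic-difference = solve 2 (λ K L → cubicᴾ K :- cubicᴾ L :=
  (K :- L) :* (K :* K :+ K :* L :+ L :* L :+ K :+ L :+ con (+ 1))) refl

cubic-cofactor≢0 : ∀ K L → K * K + K * L + L * L + K + L + + 1 ≢ + 0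
cubic-cofactor≢0 K L q≡0 = 2+squares≢0 (+ 2 * K + L + + 1) (L + + 1) L (begin
  + 2 + ((+ 2 * K + L + + 1) * (+ 2 * K + L + + 1) + (L + + 1) * (L + + 1) + (L * L + L * L))
    ≡⟨ quadruple K L ⟩
  + 4 * (K * K + K * L + L * L + K + L + + 1)
    ≡⟨ cong (+ 4 *_) q≡0 ⟩
  + 0 ∎)
  where
  open ≡-Reasoning
  quadruple : ∀ K L → + 2 + ((+ 2 * K + L + + 1) * (+ 2 * K + L + + 1) + (L + + 1) * (L + + 1) + (L * L + L * L))
                      ≡ + 4 * (K * K + K * L + L * L + K + L + + 1)
  quadruple = solve-∀

cubic-injective : Injective _≡_ _≡_ cubic
cubic-injective {K} {L} cubicK≡cubicL
  with ℤ.i*j≡0⇒i≡0∨j≡0 (K - L) (trans (sym (cubic-difference K L)) (ℤ.i≡j⇒i-j≡0 cubicK≡cubicL))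
... | inj₁ K-L≡0 = ℤ.i-j≡0⇒i≡j K L K-L≡0
... | inj₂ q≡0   = contradiction q≡0 (cubic-cofactor≢0 K L)

squares∧bezout⇒good : ∀ {k A B} r .{{_ : NonZero r}} (x : Fin 4 → ℤ) →
       (∀ n → x n * x n ≡ A * (k ^ r) ^ toℕ n + B) →
       ∀ U V m → U * A + V * B ≡ + (2 ℕ.^ m) → Odd B → Good k (A , B)
squares∧bezout⇒good {k} {A} {B} r x squares U V m bezout odd-B =
  subst SquareFree (sym (gcdℤ≡1 U V m bezout odd-B)) squareFree-1 ,
  atLeastFourSolutions-power {k} {A} {B} r x squares

evenAᴾ evenBᴾ evenUᴾ evenVᴾ : ∀ {n} → Polynomial n → Polynomial n
evenAᴾ K = con (+ 8) :* cubicᴾ K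
evenBᴾ K = con (+ 1) :- con (+ 2) :* K :- K :^ 2 :- con (+ 12) :* K :^ 3 :- K :^ 4
           :- con (+ 2) :* K :^ 5 :+ K :^ 6
evenUᴾ K = con (+ 33) :- con (+ 31) :* K :- con (+ 10) :* K :^ 2 :- con (+ 10) :* K :^ 3
           :+ K :^ 4 :+ K :^ 5
evenVᴾ K = :- con (+ 8) :- con (+ 32) :* K :- con (+ 8) :* K :^ 2

evenRootᴾ : Fin 4 → ∀ {n} → Polynomial n → Polynomial n
evenRootᴾ 0F                      K = con (+ 3) :+ K :+ K :^ 2 :- K :^ 3
evenRootᴾ (sucF 0F)               K = con (+ 1) :+ con (+ 3) :* K :- K :^ 2 :+ K :^ 3
evenRootᴾ (sucF (sucF 0F))        K = :- con (+ 1) :+ K :- con (+ 3) :* K :^ 2 :- K :^ 3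
evenRootᴾ (sucF (sucF (sucF 0F))) K = :- con (+ 1) :+ K :+ K :^ 2 :+ con (+ 3) :* K :^ 3

evenFamily : ℤ → ℤ × ℤ
evenFamily K = eval evenAᴾ K , eval evenBᴾ K

evenRoot-equationᴾ : Fin 4 → Polynomial 1 → Polynomial 1 × Polynomial 1
evenRoot-equationᴾ n K = evenRootᴾ n K :* evenRootᴾ n K := evenAᴾ K :* K :^ toℕ n :+ evenBᴾ K

evenRoot-square : ∀ n K → eval (evenRootᴾ n) K * eval (evenRootᴾ n) K ≡
                          eval evenAᴾ K * K ^ toℕ n + eval evenBᴾ K
evenRoot-square 0F                      = solve 1 (evenRoot-equationᴾ 0F) refl
evenRoot-square (sucF 0F)               = solve 1 (evenRoot-equationᴾ (sucF 0F)) refl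
evenRoot-square (sucF (sucF 0F))        = solve 1 (evenRoot-equationᴾ (sucF (sucF 0F))) refl
evenRoot-square (sucF (sucF (sucF 0F))) = solve 1 (evenRoot-equationᴾ (sucF (sucF (sucF 0F)))) refl

evenBezout : ∀ K → eval evenUᴾ K * eval evenAᴾ K + eval evenVᴾ K * eval evenBᴾ K ≡ + (2 ℕ.^ 8)
evenBezout = solve 1 (λ K → evenUᴾ K :* evenAᴾ K :+ evenVᴾ K :* evenBᴾ K := con (+ 256)) refl

evenB-odd : ∀ {K} → Even K → Odd (eval evenBᴾ K)
evenB-odd (j , refl) = eval halfᴾ j ,
  solve 1 (λ j → evenBᴾ (con (+ 2) :* j) := con (+ 1) :+ con (+ 2) :* halfᴾ j) refl j
  where
  halfᴾ : ∀ {n} → Polynomial n → Polynomial n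
  halfᴾ j = :- con (+ 2) :* j :- con (+ 2) :* j :^ 2 :- con (+ 48) :* j :^ 3 :- con (+ 8) :* j :^ 4
            :- con (+ 32) :* j :^ 5 :+ con (+ 32) :* j :^ 6

evenFamily-good : ∀ k r .{{_ : NonZero r}} → Even (k ^ r) → Good k (evenFamily (k ^ r))
evenFamily-good k r even-K =
  squares∧bezout⇒good r (λ n → eval (evenRootᴾ n) K) (λ n → evenRoot-square n K)
       (eval evenUᴾ K) (eval evenVᴾ K) 8 (evenBezout K) (evenB-odd even-K)
  where K = k ^ r

evenFamily-injective : Injective _≡_ _≡_ evenFamily
evenFamily-injective same = cubic-injective (ℤ.*-cancelˡ-≡ (+ 8) _ _ (cong proj₁ same))

oddAᴾ oddBᴾ oddUᴾ oddVᴾ : ∀ {n} → Polynomial n → Polynomial n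
oddAᴾ J = con (+ 2) :+ con (+ 6) :* J :+ con (+ 8) :* J :^ 2 :+ con (+ 4) :* J :^ 3
oddBᴾ J = :- con (+ 1) :- con (+ 6) :* J :- con (+ 12) :* J :^ 2 :- con (+ 8) :* J :^ 3
          :+ con (+ 4) :* J :^ 4 :+ con (+ 8) :* J :^ 5 :+ con (+ 4) :* J :^ 6
oddUᴾ J = :- con (+ 1) :- con (+ 9) :* J :- con (+ 6) :* J :^ 2 :+ con (+ 2) :* J :^ 3
          :+ con (+ 6) :* J :^ 4 :+ con (+ 2) :* J :^ 5
oddVᴾ J = :- con (+ 3) :- con (+ 6) :* J :- con (+ 2) :* J :^ 2

oddRootᴾ : Fin 4 → ∀ {n} → Polynomial n → Polynomial n
oddRootᴾ 0F                      J = con (+ 1) :- con (+ 2) :* J :^ 2 :- con (+ 2) :* J :^ 3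
oddRootᴾ (sucF 0F)               J = con (+ 1) :+ con (+ 2) :* J :+ con (+ 2) :* J :^ 2 :+ con (+ 2) :* J :^ 3
oddRootᴾ (sucF (sucF 0F))        J = :- con (+ 1) :- con (+ 4) :* J :- con (+ 6) :* J :^ 2 :- con (+ 2) :* J :^ 3
oddRootᴾ (sucF (sucF (sucF 0F))) J = con (+ 1) :+ con (+ 6) :* J :+ con (+ 10) :* J :^ 2 :+ con (+ 6) :* J :^ 3

oddFamily : ℤ → ℤ × ℤ
oddFamily J = eval oddAᴾ J , eval oddBᴾ J

oddRoot-equationᴾ : Fin 4 → Polynomial 1 → Polynomial 1 × Polynomial 1
oddRoot-equationᴾ n J =
  oddRootᴾ n J :* oddRootᴾ n J := oddAᴾ J :* (con (+ 1) :+ con (+ 2) :* J) :^ toℕ n :+ oddBᴾ J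

oddRoot-square : ∀ n J → eval (oddRootᴾ n) J * eval (oddRootᴾ n) J ≡
                         eval oddAᴾ J * (+ 1 + + 2 * J) ^ toℕ n + eval oddBᴾ J
oddRoot-square 0F                      = solve 1 (oddRoot-equationᴾ 0F) refl
oddRoot-square (sucF 0F)               = solve 1 (oddRoot-equationᴾ (sucF 0F)) refl
oddRoot-square (sucF (sucF 0F))        = solve 1 (oddRoot-equationᴾ (sucF (sucF 0F))) refl
oddRoot-square (sucF (sucF (sucF 0F))) = solve 1 (oddRoot-equationᴾ (sucF (sucF (sucF 0F)))) refl

oddBezout : ∀ J → eval oddUᴾ J * eval oddAᴾ J + eval oddVᴾ J * eval oddBᴾ J ≡ + (2 ℕ.^ 0)
oddBezout = solve 1 (λ J → oddUᴾ J :* oddAᴾ J :+ oddVᴾ J :* oddBᴾ J := con (+ 1)) refl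

oddB-odd : ∀ J → Odd (eval oddBᴾ J)
oddB-odd J = eval halfᴾ J , solve 1 (λ J → oddBᴾ J := con (+ 1) :+ con (+ 2) :* halfᴾ J) refl J
  where
  halfᴾ : ∀ {n} → Polynomial n → Polynomial n
  halfᴾ J = :- con (+ 1) :- con (+ 3) :* J :- con (+ 6) :* J :^ 2 :- con (+ 4) :* J :^ 3
            :+ con (+ 2) :* J :^ 4 :+ con (+ 4) :* J :^ 5 :+ con (+ 2) :* J :^ 6

oddA-double : ∀ J → + 2 * eval oddAᴾ J ≡ cubic (+ 1 + + 2 * J)
oddA-double = solve 1 (λ J → con (+ 2) :* oddAᴾ J := cubicᴾ (con (+ 1) :+ con (+ 2) :* J)) refl

oddFamily-good : ∀ k r .{{_ : NonZero r}} (odd-K : Odd (k ^ r)) → Good k (oddFamily (proj₁ odd-K))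
oddFamily-good k r (J , K≡1+2J) =
  squares∧bezout⇒good r (λ n → eval (oddRootᴾ n) J) squares
       (eval oddUᴾ J) (eval oddVᴾ J) 0 (oddBezout J) (oddB-odd J)
  where
  squares : ∀ n → eval (oddRootᴾ n) J * eval (oddRootᴾ n) J ≡ eval oddAᴾ J * (k ^ r) ^ toℕ n + eval oddBᴾ J
  squares n rewrite K≡1+2J = oddRoot-square n J

oddFamily-injective : Injective _≡_ _≡_ oddFamily
oddFamily-injective {J} {J′} same = ℤ.*-cancelˡ-≡ (+ 2) J J′ (+-cancelˡ (+ 1) _ _ (cubic-injective (begin
  cubic (+ 1 + + 2 * J)   ≡⟨ sym (oddA-double J) ⟩
  + 2 * eval oddAᴾ J      ≡⟨ cong (+ 2 *_) (cong proj₁ same) ⟩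
  + 2 * eval oddAᴾ J′     ≡⟨ oddA-double J′ ⟩
  cubic (+ 1 + + 2 * J′)  ∎)))
  where open ≡-Reasoning

GoodSequence : ℤ → Set
GoodSequence k = Σ (ℕ → ℤ × ℤ) λ f → Injective _≡_ _≡_ f × (∀ i → Good k (f i))

goodSequence-even : ∀ k → 2 ≤ ∣ k ∣ → Even k → GoodSequence k
goodSequence-even k 2≤∣k∣ even-k =
  (λ i → evenFamily (k ^ suc i)) ,
  (λ {i} {i′} → ℕ.suc-injective ∘ ^-injectiveʳ k 2≤∣k∣ ∘ evenFamily-injective {k ^ suc i} {k ^ suc i′}) ,
  λ i → evenFamily-good k (suc i) (even-^-suc even-k i)

goodSequence-odd : ∀ k → 2 ≤ ∣ k ∣ → Odd k → GoodSequence k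
goodSequence-odd k 2≤∣k∣ odd-k =
  oddFamily ∘ J ,
  (λ {i} {i′} → ℕ.suc-injective ∘ ^-injectiveʳ k 2≤∣k∣ ∘ K-injective {i} {i′} ∘ oddFamily-injective) ,
  λ i → oddFamily-good k (suc i) (odd-K i)
  where
  odd-K : ∀ i → Odd (k ^ suc i)
  odd-K i = odd-^ odd-k (suc i)
  J : ℕ → ℤ
  J i = proj₁ (odd-K i)
  K-injective : ∀ {i i′} → J i ≡ J i′ → k ^ suc i ≡ k ^ suc i′
  K-injective {i} {i′} Ji≡Ji′ =
    trans (proj₂ (odd-K i)) (trans (cong (λ j → + 1 + + 2 * j) Ji≡Ji′) (sym (proj₂ (odd-K i′))))

theorem2p1 : (k : ℤ) → 2 ≤ ∣ k ∣ →
    Σ (ℕ → ℤ × ℤ) λ f → Injective _≡_ _≡_ f × (∀ i → Good k (f i))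
theorem2p1 k 2≤∣k∣ with even⊎odd k
... | inj₁ even-k = goodSequence-even k 2≤∣k∣ even-k
... | inj₂ odd-k  = goodSequence-odd k 2≤∣k∣ odd-k
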